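{- Fix $\mathbf r\in\mathbb N^I$, $\mathbf c\in\mathbb N^J$ with $\sum_i r_i=\sum_j c_j$. Let $\mathcal S=\{\mathbf g_1,\dots,\mathbf g_N\}$ be a multiset of $I\times J$ integer matrices, each of which is either a proper graph or a graph with collision (so none has a negative entry), and suppose that $\mathbf g_k$ and $\mathbf g_{k'}$ ($k\ne k'$) contain collisions. If $\sum_{j=1}^J\big(g_k(ij)+g_{k'}(ij)\big)=2r_i$ for each $i\in[I]$, then there is a swap operation among $\mathbf g_k$ and $\mathbf g_{k'}$ after which both resulting matrices are proper graphs (i.e. all collisions are resolved).
   Context: A proper graph is a nonnegative integer $I\times J$ matrix with row sums $\mathbf r$ and column sums $\mathbf c$. A graph with collision is a nonnegative integer $I\times J$ matrix $\mathbf g$ with column sums $\mathbf c$ such that for some $i^*$, $\sum_j g(i^*j)=r_{i^*}+1$, and $\sum_j g(ij)\le r_i+1$ for all $i\ne i^*$. A swap operation among $\mathbf g_{k_1},\mathbf g_{k_2}$ replaces them by $\mathbf g_{k_1}+Z$ and $\mathbf g_{k_2}-Z$, where $Z$ is a sum of finitely many matrices each having $+1$ in an entry $(i_2,j)$, $-1$ in an entry $(i_1,j)$ of the same column $j$, and $0$ elsewhere; the other elements of the multiset are unchanged. -}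

module Defs where

open import Data.Nat using (ℕ; zero; suc; _+_; _≤_)
open import Data.Integer as ℤ using (ℤ; +_)
open import Data.Fin using (Fin; zero; suc)
open import Data.List using (List; []; _∷_)
open import Data.Product using (Σ; _×_; ∃)
open import Relation.Binary.PropositionalEquality using (_≡_; _≢_)
open import Relation.Nullary.Decidable using (⌊_⌋)
open import Data.Fin using (_≟_)
open import Data.Bool using (if_then_else_)

sumFin : (n : ℕ) → (Fin n → ℕ) → ℕ
sumFin zero    f = 0
sumFin (suc n) f = f zero + sumFin n (λ x → f (suc x))

Mat : ℕ → ℕ → Set
Mat I J = Fin I → Fin J → ℕ

Matℤ : ℕ → ℕ → Set
Matℤ I J = Fin I → Fin J → ℤ

rowSum : ∀ {I J} → Mat I J → Fin I → ℕ
rowSum {I} {J} g i = sumFin J (λ j → g i j)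

colSum : ∀ {I J} → Mat I J → Fin J → ℕ
colSum {I} {J} g j = sumFin I (λ i → g i j)

Proper : ∀ {I J} → (Fin I → ℕ) → (Fin J → ℕ) → Mat I J → Set
Proper r c g = (∀ i → rowSum g i ≡ r i) × (∀ j → colSum g j ≡ c j)

WithCollision : ∀ {I J} → (Fin I → ℕ) → (Fin J → ℕ) → Mat I J → Set
WithCollision r c g =
  (∀ j → colSum g j ≡ c j) ×
  (Σ _ λ i* → (rowSum g i* ≡ suc (r i*)) × (∀ i → i ≢ i* → rowSum g i ≤ suc (r i)))

record Move (I J : ℕ) : Set where
  constructor move
  field
    from : Fin I
    to   : Fin I
    col  : Fin J

indicator : ∀ {n} → Fin n → Fin n → ℤ
indicator a b = if ⌊ a ≟ b ⌋ then + 1 else + 0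

moveMat : ∀ {I J} → Move I J → Matℤ I J
moveMat (move i₁ i₂ j) i j' =
  (indicator i i₂ ℤ.* indicator j' j) ℤ.- (indicator i i₁ ℤ.* indicator j' j)

-- Z = sum of finitely many elementary moves
swapMat : ∀ {I J} → List (Move I J) → Matℤ I J
swapMat []       i j = + 0
swapMat (m ∷ ms) i j = moveMat m i j ℤ.+ swapMat ms i j

-- the integer matrix h is (equal to) a proper graph (in particular, nonnegative)
ProperℤMat : ∀ {I J} → (Fin I → ℕ) → (Fin J → ℕ) → Matℤ I J → Set
ProperℤMat r c h = Σ (Mat _ _) λ g → (∀ i j → h i j ≡ + g i j) × Proper r c g

-- Put S = g_k + g_k′.  By hypothesis its row sums are 2r, and since both
-- matrices have column sums c its column sums are 2c.  The heart of the proof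
-- is a halving theorem (module Halving): a nonnegative integer matrix with
-- margins (2r, 2c) is the sum of two nonnegative integer matrices with margins
-- (r, c).  It is proved by induction on Σ r.  A row with r_i > 0 contains two
-- units (i, j), (i, j′) of S.  If j = j′ we remove both; otherwise column j′
-- is left with odd sum, so it contains a further unit (i′, j′), and we remove
-- all three and add a unit at (i′, j).  In both cases the margins drop by
-- (2δ_i, 2δ_j′), and the two halves of the smaller matrix are repaired into
-- halves of S.
-- The second ingredient (module Routing) is that two matrices with equal
-- column sums are joined by a swap: route every unit through a hub row b.
-- Writing S = h₁ + h₂, the swap taking g_k to h₁ takes g_k′ to
-- g_k + g_k′ − h₁ = h₂, so both results are proper graphs.
module Submission where

open import Defs

module Halving where
  open import Data.Nat using (ℕ; zero; suc; _+_; _*_; _∸_; _≤_; z≤n; s≤s)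
  open import Data.Nat.Properties
    using (+-identityʳ; +-comm; +-assoc; *-comm; *-identityʳ; m≤m+n; m≤n+m; ≤-trans; m∸n+n≡m;
           +-cancelʳ-≡; suc-injective; 0≢1+n; +-suc; m+n≡0⇒m≡0; n≤0⇒n≡0)
  open import Data.Nat.Tactic.RingSolver using (solve-∀)
  open import Data.Fin using (Fin; zero; suc; _≟_)
  open import Data.Product using (Σ; _,_; proj₁; proj₂)
  open import Data.Sum using (_⊎_; inj₁; inj₂)
  open import Data.Empty using (⊥-elim)
  open import Function using (_∘_)
  open import Relation.Binary.PropositionalEquality
    using (_≡_; _≢_; refl; sym; trans; cong; cong₂; subst; module ≡-Reasoning)
  open import Relation.Nullary using (yes; no)
  open ≡-Reasoning

  sumFin-cong : ∀ n {f g : Fin n → ℕ} → (∀ x → f x ≡ g x) → sumFin n f ≡ sumFin n g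
  sumFin-cong zero    _   = refl
  sumFin-cong (suc n) f≗g = cong₂ _+_ (f≗g zero) (sumFin-cong n (f≗g ∘ suc))

  sumFin-zero : ∀ n → sumFin n (λ _ → 0) ≡ 0
  sumFin-zero zero    = refl
  sumFin-zero (suc n) = sumFin-zero n

  sumFin-+ : ∀ n (f g : Fin n → ℕ) → sumFin n (λ x → f x + g x) ≡ sumFin n f + sumFin n g
  sumFin-+ zero    _ _ = refl
  sumFin-+ (suc n) f g =
    trans (cong (f zero + g zero +_) (sumFin-+ n (f ∘ suc) (g ∘ suc)))
          (interchange (f zero) (g zero) _ _)
    where
    interchange : ∀ a b c d → (a + b) + (c + d) ≡ (a + c) + (b + d)
    interchange = solve-∀

  term≤sumFin : ∀ n (f : Fin n → ℕ) x → f x ≤ sumFin n f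
  term≤sumFin (suc n) f zero    = m≤m+n _ _
  term≤sumFin (suc n) f (suc x) = ≤-trans (term≤sumFin n (f ∘ suc) x) (m≤n+m _ _)

  sumFin≡0 : ∀ n (f : Fin n → ℕ) → sumFin n f ≡ 0 → ∀ x → f x ≡ 0
  sumFin≡0 n f Σf≡0 x = n≤0⇒n≡0 (subst (f x ≤_) Σf≡0 (term≤sumFin n f x))

  find-positive : ∀ n (f : Fin n → ℕ) → 1 ≤ sumFin n f → Σ (Fin n) λ x → 1 ≤ f x
  find-positive (suc n) f pos with f zero in f₀≡
  ... | suc _ = zero , subst (1 ≤_) (sym f₀≡) (s≤s z≤n)
  ... | zero  with find-positive n (f ∘ suc) pos
  ...   | x , fx>0 = suc x , fx>0

  δ : ∀ {n} → Fin n → Fin n → ℕ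
  δ zero    zero    = 1
  δ zero    (suc _) = 0
  δ (suc _) zero    = 0
  δ (suc i) (suc x) = δ i x

  δ-self : ∀ {n} (i : Fin n) → δ i i ≡ 1
  δ-self zero    = refl
  δ-self (suc i) = δ-self i

  δ-other : ∀ {n} {i x : Fin n} → x ≢ i → δ i x ≡ 0
  δ-other {i = zero}  {zero}  x≢i = ⊥-elim (x≢i refl)
  δ-other {i = zero}  {suc _} _   = refl
  δ-other {i = suc _} {zero}  _   = refl
  δ-other {i = suc i} {suc x} x≢i = δ-other (x≢i ∘ cong suc)

  sumFin-select : ∀ n (i : Fin n) (a : Fin n → ℕ) → sumFin n (λ x → δ i x * a x) ≡ a i
  sumFin-select (suc n) zero    a =
    trans (cong (a zero + 0 +_) (sumFin-zero n)) (trans (+-identityʳ _) (+-identityʳ _))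
  sumFin-select (suc n) (suc i) a = sumFin-select n i (a ∘ suc)

  sumFin-δ : ∀ n (i : Fin n) → sumFin n (δ i) ≡ 1
  sumFin-δ n i = trans (sumFin-cong n (λ x → sym (*-identityʳ (δ i x)))) (sumFin-select n i _)

  δ≤ : ∀ {n} (v : Fin n → ℕ) {i} → 1 ≤ v i → ∀ x → δ i x ≤ v x
  δ≤ v {i} vᵢ>0 x with x ≟ i
  ... | yes refl rewrite δ-self x = vᵢ>0
  ... | no x≢i   rewrite δ-other x≢i = z≤n

  unit-decrement : ∀ {n} (v : Fin n → ℕ) {i} → 1 ≤ v i →
                   Σ (Fin n → ℕ) λ v′ → ∀ x → v′ x + δ i x ≡ v x
  unit-decrement v {i} vᵢ>0 = (λ x → v x ∸ δ i x) , λ x → m∸n+n≡m (δ≤ v vᵢ>0 x)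

  sumFin-decrement : ∀ {n m} {v v′ : Fin n → ℕ} {i} → (∀ x → v′ x + δ i x ≡ v x) →
                     sumFin n v ≡ suc m → sumFin n v′ ≡ m
  sumFin-decrement {n} {m} {v} {v′} {i} v≡ Σv≡ = suc-injective (begin
    suc (sumFin n v′)                     ≡⟨ +-comm 1 (sumFin n v′) ⟩
    sumFin n v′ + 1                       ≡⟨ cong (sumFin n v′ +_) (sym (sumFin-δ n i)) ⟩
    sumFin n v′ + sumFin n (δ i)          ≡⟨ sym (sumFin-+ n v′ (δ i)) ⟩
    sumFin n (λ x → v′ x + δ i x)         ≡⟨ sumFin-cong n v≡ ⟩
    sumFin n v                            ≡⟨ Σv≡ ⟩
    suc m                                 ∎)

  odd-pos : ∀ {a} k → a + 1 ≡ k + k → 1 ≤ a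
  odd-pos {suc _} _       _ = s≤s z≤n
  odd-pos {zero}  zero    ()
  odd-pos {zero}  (suc k) a+1≡2k = ⊥-elim (0≢1+n (trans (suc-injective a+1≡2k) (+-suc k k)))

  half-pos : ∀ {k} → 1 ≤ k + k → 1 ≤ k
  half-pos {suc _} _ = s≤s z≤n

  right-comm : ∀ a b d → a + b + d ≡ a + d + b
  right-comm = solve-∀

  halve-margin : ∀ {s m r r′ d} → s ≡ m + d + d → s ≡ r + r → r′ + d ≡ r → m ≡ r′ + r′
  halve-margin {s} {m} {r} {r′} {d} s≡m+2d s≡2r r′+d≡r =
    +-cancelʳ-≡ (d + d) m (r′ + r′) (begin
      m + (d + d)                ≡⟨ sym (+-assoc m d d) ⟩
      m + d + d                  ≡⟨ sym s≡m+2d ⟩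
      s                          ≡⟨ s≡2r ⟩
      r + r                      ≡⟨ sym (cong₂ _+_ r′+d≡r r′+d≡r) ⟩
      (r′ + d) + (r′ + d)        ≡⟨ regroup r′ d ⟩
      (r′ + r′) + (d + d)        ∎)
    where
    regroup : ∀ b d → (b + d) + (b + d) ≡ (b + b) + (d + d)
    regroup = solve-∀

  -- The repair of the halves in an alternating-path step, entrywise:
  -- if h + f = h₁ and h₁ + h₂ = a + f, then (h + e₁ + e₂) + (h₂ + e₃) = a + e₁ + e₂ + e₃.
  rebalance : ∀ {h h₁ h₂ a f} e₁ e₂ e₃ → h + f ≡ h₁ → h₁ + h₂ ≡ a + f →
              (h + e₁ + e₂) + (h₂ + e₃) ≡ a + e₁ + e₂ + e₃
  rebalance {h} {h₁} {h₂} {a} {f} e₁ e₂ e₃ h+f≡h₁ h₁+h₂≡a+f =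
    trans (regroup h h₂ e₁ e₂ e₃) (cong (λ t → t + e₁ + e₂ + e₃) h+h₂≡a)
    where
    h+h₂≡a : h + h₂ ≡ a
    h+h₂≡a = +-cancelʳ-≡ f (h + h₂) a
               (trans (right-comm h h₂ f) (trans (cong (_+ h₂) h+f≡h₁) h₁+h₂≡a+f))
    regroup : ∀ h h₂ e₁ e₂ e₃ → (h + e₁ + e₂) + (h₂ + e₃) ≡ h + h₂ + e₁ + e₂ + e₃
    regroup = solve-∀

  summand-pos : ∀ a {b} → 1 ≤ a + b → 1 ≤ a ⊎ 1 ≤ b
  summand-pos zero    b>0 = inj₂ b>0
  summand-pos (suc _) _   = inj₁ (s≤s z≤n)

  double : ∀ {n} → (Fin n → ℕ) → Fin n → ℕ
  double v x = v x + v x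

  module _ {I J : ℕ} where

    infixl 6 _⊕_
    _⊕_ : Mat I J → Mat I J → Mat I J
    (A ⊕ B) x y = A x y + B x y

    -- Entrywise equality (a record, so that A and B stay visible to unification).
    infix 4 _≐_
    record _≐_ (A B : Mat I J) : Set where
      constructor entrywise
      field entry : ∀ x y → A x y ≡ B x y
    open _≐_ public

    E : Fin I → Fin J → Mat I J
    E i j x y = δ i x * δ j y

    rowSum-cong : ∀ {A B : Mat I J} → A ≐ B → ∀ x → rowSum A x ≡ rowSum B x
    rowSum-cong A≐B x = sumFin-cong J (entry A≐B x)

    colSum-cong : ∀ {A B : Mat I J} → A ≐ B → ∀ y → colSum A y ≡ colSum B y
    colSum-cong A≐B y = sumFin-cong I (λ x → entry A≐B x y)

    proper-cong : ∀ {r c} {A B : Mat I J} → A ≐ B → Proper r c B → Proper r c A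
    proper-cong A≐B (rows , cols) =
      (λ x → trans (rowSum-cong A≐B x) (rows x)) , (λ y → trans (colSum-cong A≐B y) (cols y))

    rowSum-⊕ : ∀ (A B : Mat I J) x → rowSum (A ⊕ B) x ≡ rowSum A x + rowSum B x
    rowSum-⊕ A B x = sumFin-+ J (A x) (B x)

    colSum-⊕ : ∀ (A B : Mat I J) y → colSum (A ⊕ B) y ≡ colSum A y + colSum B y
    colSum-⊕ A B y = sumFin-+ I (λ x → A x y) (λ x → B x y)

    rowSum-⊕E : ∀ (A : Mat I J) i j x → rowSum (A ⊕ E i j) x ≡ rowSum A x + δ i x
    rowSum-⊕E A i j x = trans (rowSum-⊕ A (E i j) x) (cong (rowSum A x +_) rowSum-E)
      where
      rowSum-E : rowSum (E i j) x ≡ δ i x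
      rowSum-E = trans (sumFin-cong J (λ y → *-comm (δ i x) (δ j y))) (sumFin-select J j _)

    colSum-⊕E : ∀ (A : Mat I J) i j y → colSum (A ⊕ E i j) y ≡ colSum A y + δ j y
    colSum-⊕E A i j y =
      trans (colSum-⊕ A (E i j) y) (cong (colSum A y +_) (sumFin-select I i (λ _ → δ j y)))

    rowSum-⊕E⊕E : ∀ (A : Mat I J) i j i′ j′ x →
                  rowSum (A ⊕ E i j ⊕ E i′ j′) x ≡ rowSum A x + δ i x + δ i′ x
    rowSum-⊕E⊕E A i j i′ j′ x =
      trans (rowSum-⊕E (A ⊕ E i j) i′ j′ x) (cong (_+ δ i′ x) (rowSum-⊕E A i j x))

    colSum-⊕E⊕E : ∀ (A : Mat I J) i j i′ j′ y →
                  colSum (A ⊕ E i j ⊕ E i′ j′) y ≡ colSum A y + δ j y + δ j′ y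
    colSum-⊕E⊕E A i j i′ j′ y =
      trans (colSum-⊕E (A ⊕ E i j) i′ j′ y) (cong (_+ δ j′ y) (colSum-⊕E A i j y))

    peel : (S : Mat I J) {i : Fin I} {j : Fin J} → 1 ≤ S i j → Σ (Mat I J) λ A → A ⊕ E i j ≐ S
    peel S {i} {j} Sᵢⱼ>0 = (λ x y → S x y ∸ E i j x y) , entrywise λ x y → m∸n+n≡m (E≤S x y)
      where
      E≤S : ∀ x y → E i j x y ≤ S x y
      E≤S x y with x ≟ i
      ... | yes refl rewrite δ-self x | +-identityʳ (δ j y) = δ≤ (S x) Sᵢⱼ>0 y
      ... | no x≢i   rewrite δ-other x≢i = z≤n

    proper-⊕E : ∀ {r r′ c c′} {h : Mat I J} {i j} → Proper r′ c′ h →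
                (∀ x → r′ x + δ i x ≡ r x) → (∀ y → c′ y + δ j y ≡ c y) →
                Proper r c (h ⊕ E i j)
    proper-⊕E {h = h} {i} {j} (rows , cols) r≡ c≡ =
      (λ x → trans (rowSum-⊕E h i j x) (trans (cong (_+ δ i x) (rows x)) (r≡ x))) ,
      (λ y → trans (colSum-⊕E h i j y) (trans (cong (_+ δ j y) (cols y)) (c≡ y)))

    proper-exchange : ∀ {r r′ c c′} {h : Mat I J} {i j i′ j′} → Proper r′ c′ (h ⊕ E i′ j) →
                      (∀ x → r′ x + δ i x ≡ r x) → (∀ y → c′ y + δ j′ y ≡ c y) →
                      Proper r c (h ⊕ E i′ j′ ⊕ E i j)
    proper-exchange {r} {r′} {c} {c′} {h} {i} {j} {i′} {j′} (rows , cols) r≡ c≡ = rows′ , cols′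
      where
      rows′ : ∀ x → rowSum (h ⊕ E i′ j′ ⊕ E i j) x ≡ r x
      rows′ x = begin
        rowSum (h ⊕ E i′ j′ ⊕ E i j) x   ≡⟨ rowSum-⊕E (h ⊕ E i′ j′) i j x ⟩
        rowSum (h ⊕ E i′ j′) x + δ i x   ≡⟨ cong (_+ δ i x) (rowSum-⊕E h i′ j′ x) ⟩
        rowSum h x + δ i′ x + δ i x      ≡⟨ cong (_+ δ i x) (sym (rowSum-⊕E h i′ j x)) ⟩
        rowSum (h ⊕ E i′ j) x + δ i x    ≡⟨ cong (_+ δ i x) (rows x) ⟩
        r′ x + δ i x                     ≡⟨ r≡ x ⟩
        r x                              ∎
      cols′ : ∀ y → colSum (h ⊕ E i′ j′ ⊕ E i j) y ≡ c y
      cols′ y = begin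
        colSum (h ⊕ E i′ j′ ⊕ E i j) y   ≡⟨ colSum-⊕E (h ⊕ E i′ j′) i j y ⟩
        colSum (h ⊕ E i′ j′) y + δ j y   ≡⟨ cong (_+ δ j y) (colSum-⊕E h i′ j′ y) ⟩
        colSum h y + δ j′ y + δ j y      ≡⟨ right-comm (colSum h y) (δ j′ y) (δ j y) ⟩
        colSum h y + δ j y + δ j′ y      ≡⟨ cong (_+ δ j′ y) (sym (colSum-⊕E h i′ j y)) ⟩
        colSum (h ⊕ E i′ j) y + δ j′ y   ≡⟨ cong (_+ δ j′ y) (cols y) ⟩
        c′ y + δ j′ y                    ≡⟨ c≡ y ⟩
        c y                              ∎

    record Halves (S : Mat I J) (r : Fin I → ℕ) (c : Fin J → ℕ) : Set where
      field
        half₁ half₂ : Mat I J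
        halves-sum  : half₁ ⊕ half₂ ≐ S
        proper₁     : Proper r c half₁
        proper₂     : Proper r c half₂

    swap-halves : ∀ {S r c} → Halves S r c → Halves S r c
    swap-halves H = record
      { half₁ = half₂ ; half₂ = half₁
      ; halves-sum = entrywise λ x y → trans (+-comm (half₂ x y) (half₁ x y)) (entry halves-sum x y)
      ; proper₁ = proper₂ ; proper₂ = proper₁ }
      where open Halves H

    row-after-peel : ∀ (A : Mat I J) i j {S} → A ⊕ E i j ≐ S → rowSum A i + 1 ≡ rowSum S i
    row-after-peel A i j {S} A≐S = begin
      rowSum A i + 1             ≡⟨ cong (rowSum A i +_) (sym (δ-self i)) ⟩
      rowSum A i + δ i i         ≡⟨ sym (rowSum-⊕E A i j i) ⟩
      rowSum (A ⊕ E i j) i       ≡⟨ rowSum-cong A≐S i ⟩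
      rowSum S i                 ∎

    col-after-peel : ∀ (A : Mat I J) i j {S} → A ⊕ E i j ≐ S → colSum A j + 1 ≡ colSum S j
    col-after-peel A i j {S} A≐S = begin
      colSum A j + 1             ≡⟨ cong (colSum A j +_) (sym (δ-self j)) ⟩
      colSum A j + δ j j         ≡⟨ sym (colSum-⊕E A i j j) ⟩
      colSum (A ⊕ E i j) j       ≡⟨ colSum-cong A≐S j ⟩
      colSum S j                 ∎

    -- A row of S with positive target contains two units (i, j), (i, j′),
    -- the second one found by parity after removing the first.
    two-in-row : ∀ {S r c i} → Proper (double r) (double c) S → 1 ≤ r i →
                 Σ (Fin J) λ j → Σ (Fin J) λ j′ → Σ (Mat I J) λ B → B ⊕ E i j ⊕ E i j′ ≐ S
    two-in-row {S} {r} {i = i} (rows , _) rᵢ>0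
      with find-positive J (S i) (≤-trans rᵢ>0 (subst (r i ≤_) (sym (rows i)) (m≤m+n _ _)))
    ... | j′ , Sᵢⱼ′>0 with peel S Sᵢⱼ′>0
    ... | S₁ , S₁≐S
      with find-positive J (S₁ i) (odd-pos (r i) (trans (row-after-peel S₁ i j′ S₁≐S) (rows i)))
    ... | j , S₁ᵢⱼ>0 with peel S₁ S₁ᵢⱼ>0
    ... | B , B≐S₁ =
      j , j′ , B , entrywise λ x y → trans (cong (_+ E i j′ x y) (entry B≐S₁ x y)) (entry S₁≐S x y)

    -- After removing units at (i, j) and (i, j′) with j ≠ j′, column j′ has
    -- odd sum and hence contains a further unit (i′, j′).
    one-more-in-column : ∀ {S B : Mat I J} {k i j j′} → B ⊕ E i j ⊕ E i j′ ≐ S → j′ ≢ j →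
                         colSum S j′ ≡ k + k →
                         Σ (Fin I) λ i′ → Σ (Mat I J) λ A → A ⊕ E i′ j′ ≐ B
    one-more-in-column {S} {B} {k} {i} {j} {j′} B≐S j′≢j col≡2k
      with find-positive I (λ x → B x j′) (odd-pos k (trans odd-column col≡2k))
      where
      odd-column : colSum B j′ + 1 ≡ colSum S j′
      odd-column = begin
        colSum B j′ + 1                    ≡⟨ cong (_+ 1) (sym (+-identityʳ _)) ⟩
        colSum B j′ + 0 + 1                ≡⟨ cong (λ t → colSum B j′ + t + 1) (sym (δ-other j′≢j)) ⟩
        colSum B j′ + δ j j′ + 1           ≡⟨ cong (_+ 1) (sym (colSum-⊕E B i j j′)) ⟩
        colSum (B ⊕ E i j) j′ + 1          ≡⟨ col-after-peel (B ⊕ E i j) i j′ B≐S ⟩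
        colSum S j′                        ∎
    ... | i′ , Bᵢ′ⱼ′>0 = i′ , peel B Bᵢ′ⱼ′>0

    -- S contains either a doubled unit
    -- (i, j), or units (i′, j′), (i, j), (i, j′) forming an alternating path;
    -- the smaller instance is A, resp. A ⊕ E i′ j, with targets r − δ i, c − δ j′
    -- (j′ = j in the first case).
    data Reduction (S : Mat I J) (r : Fin I → ℕ) (c : Fin J → ℕ) : Set where
      doubled : ∀ i j (A : Mat I J) (r′ : Fin I → ℕ) (c′ : Fin J → ℕ) →
                A ⊕ E i j ⊕ E i j ≐ S →
                (∀ x → r′ x + δ i x ≡ r x) → (∀ y → c′ y + δ j y ≡ c y) → Reduction S r c
      path    : ∀ i j i′ j′ (A : Mat I J) (r′ : Fin I → ℕ) (c′ : Fin J → ℕ) →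
                A ⊕ E i′ j′ ⊕ E i j ⊕ E i j′ ≐ S →
                (∀ x → r′ x + δ i x ≡ r x) → (∀ y → c′ y + δ j′ y ≡ c y) → Reduction S r c

    reduce : ∀ {S r c} → 1 ≤ sumFin I r → Proper (double r) (double c) S → Reduction S r c
    reduce {S} {r} {c} Σr>0 PS@(_ , cols) with find-positive I r Σr>0
    ... | i , rᵢ>0 with unit-decrement r rᵢ>0 | two-in-row {S} {r} {c} {i} PS rᵢ>0
    ... | r′ , r≡ | j , j′ , B , B≐S with unit-decrement c (half-pos cⱼ′-doubled>0)
      where
      cⱼ′-doubled>0 : 1 ≤ c j′ + c j′
      cⱼ′-doubled>0 = subst (1 ≤_) (trans (col-after-peel (B ⊕ E i j) i j′ B≐S) (cols j′)) (m≤n+m 1 _)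
    ... | c′ , c≡ with j ≟ j′
    ...   | yes refl = doubled i j B r′ c′ B≐S r≡ c≡
    ...   | no j≢j′ with one-more-in-column {k = c j′} {i} {j} {j′} B≐S (j≢j′ ∘ sym) (cols j′)
    ...     | i′ , A , A≐B = path i j i′ j′ A r′ c′ A≐S r≡ c≡
      where
      A≐S : A ⊕ E i′ j′ ⊕ E i j ⊕ E i j′ ≐ S
      A≐S = entrywise λ x y →
        trans (cong (λ t → t + E i j x y + E i j′ x y) (entry A≐B x y)) (entry B≐S x y)

    doubled-margins : ∀ {S A r r′ c c′ i j} → A ⊕ E i j ⊕ E i j ≐ S →
                      (∀ x → r′ x + δ i x ≡ r x) → (∀ y → c′ y + δ j y ≡ c y) →
                      Proper (double r) (double c) S → Proper (double r′) (double c′) A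
    doubled-margins {A = A} {i = i} {j} A≐S r≡ c≡ (rows , cols) =
      (λ x → halve-margin (trans (sym (rowSum-cong A≐S x)) (rowSum-⊕E⊕E A i j i j x)) (rows x) (r≡ x)) ,
      (λ y → halve-margin (trans (sym (colSum-cong A≐S y)) (colSum-⊕E⊕E A i j i j y)) (cols y) (c≡ y))

    path-margins : ∀ {S A r r′ c c′ i j i′ j′} → A ⊕ E i′ j′ ⊕ E i j ⊕ E i j′ ≐ S →
                   (∀ x → r′ x + δ i x ≡ r x) → (∀ y → c′ y + δ j′ y ≡ c y) →
                   Proper (double r) (double c) S → Proper (double r′) (double c′) (A ⊕ E i′ j)
    path-margins {S} {A} {i = i} {j} {i′} {j′} A≐S r≡ c≡ (rows , cols) =
      (λ x → halve-margin (rows≡ x) (rows x) (r≡ x)) , (λ y → halve-margin (cols≡ y) (cols y) (c≡ y))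
      where
      rows≡ : ∀ x → rowSum S x ≡ rowSum (A ⊕ E i′ j) x + δ i x + δ i x
      rows≡ x = begin
        rowSum S x                                 ≡⟨ sym (rowSum-cong A≐S x) ⟩
        rowSum (A ⊕ E i′ j′ ⊕ E i j ⊕ E i j′) x    ≡⟨ rowSum-⊕E⊕E (A ⊕ E i′ j′) i j i j′ x ⟩
        rowSum (A ⊕ E i′ j′) x + δ i x + δ i x     ≡⟨ cong (λ t → t + δ i x + δ i x) same-row ⟩
        rowSum (A ⊕ E i′ j) x + δ i x + δ i x      ∎
        where
        same-row : rowSum (A ⊕ E i′ j′) x ≡ rowSum (A ⊕ E i′ j) x
        same-row = trans (rowSum-⊕E A i′ j′ x) (sym (rowSum-⊕E A i′ j x))
      cols≡ : ∀ y → colSum S y ≡ colSum (A ⊕ E i′ j) y + δ j′ y + δ j′ y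
      cols≡ y = begin
        colSum S y
          ≡⟨ sym (colSum-cong A≐S y) ⟩
        colSum (A ⊕ E i′ j′ ⊕ E i j ⊕ E i j′) y
          ≡⟨ colSum-⊕E (A ⊕ E i′ j′ ⊕ E i j) i j′ y ⟩
        colSum (A ⊕ E i′ j′ ⊕ E i j) y + δ j′ y
          ≡⟨ cong (_+ δ j′ y) (colSum-⊕E⊕E A i′ j′ i j y) ⟩
        colSum A y + δ j′ y + δ j y + δ j′ y
          ≡⟨ cong (_+ δ j′ y) (right-comm (colSum A y) (δ j′ y) (δ j y)) ⟩
        colSum A y + δ j y + δ j′ y + δ j′ y
          ≡⟨ cong (λ t → t + δ j′ y + δ j′ y) (sym (colSum-⊕E A i′ j y)) ⟩
        colSum (A ⊕ E i′ j) y + δ j′ y + δ j′ y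
          ∎

    lift-doubled : ∀ {S A r r′ c c′ i j} → A ⊕ E i j ⊕ E i j ≐ S →
                   (∀ x → r′ x + δ i x ≡ r x) → (∀ y → c′ y + δ j y ≡ c y) →
                   Halves A r′ c′ → Halves S r c
    lift-doubled {i = i} {j} A≐S r≡ c≡ H = record
      { half₁ = half₁ ⊕ E i j ; half₂ = half₂ ⊕ E i j
      ; halves-sum = entrywise λ x y →
          trans (regroup (half₁ x y) (half₂ x y) (E i j x y))
                (trans (cong (λ t → t + E i j x y + E i j x y) (entry halves-sum x y)) (entry A≐S x y))
      ; proper₁ = proper-⊕E {i = i} {j} proper₁ r≡ c≡
      ; proper₂ = proper-⊕E {i = i} {j} proper₂ r≡ c≡ }
      where
      open Halves H
      regroup : ∀ a b e → (a + e) + (b + e) ≡ a + b + e + e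
      regroup = solve-∀

    -- In the path case, if the first half has a unit at (i′, j), move it to
    -- (i′, j′) and add (i, j) to the first half and (i, j′) to the second.
    exchange : ∀ {S A r r′ c c′ i j i′ j′} → A ⊕ E i′ j′ ⊕ E i j ⊕ E i j′ ≐ S →
               (∀ x → r′ x + δ i x ≡ r x) → (∀ y → c′ y + δ j′ y ≡ c y) →
               (H : Halves (A ⊕ E i′ j) r′ c′) → 1 ≤ Halves.half₁ H i′ j → Halves S r c
    exchange {i = i} {j} {i′} {j′} A≐S r≡ c≡ H pos = record
      { half₁ = h ⊕ E i′ j′ ⊕ E i j ; half₂ = half₂ ⊕ E i j′
      ; halves-sum = entrywise λ x y →
          trans (rebalance (E i′ j′ x y) (E i j x y) (E i j′ x y) (entry h≐ x y) (entry halves-sum x y))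
                (entry A≐S x y)
      ; proper₁ = proper-exchange {i = i} {j} {i′} {j′} (proper-cong h≐ proper₁) r≡ c≡
      ; proper₂ = proper-⊕E {i = i} {j′} proper₂ r≡ c≡ }
      where
      open Halves H
      h : Mat I J
      h = proj₁ (peel half₁ pos)
      h≐ : h ⊕ E i′ j ≐ half₁
      h≐ = proj₂ (peel half₁ pos)

    -- (i′, j) is a unit of A ⊕ E i′ j, so one of the halves has a unit there.
    lift-path : ∀ {S A r r′ c c′ i j i′ j′} → A ⊕ E i′ j′ ⊕ E i j ⊕ E i j′ ≐ S →
                (∀ x → r′ x + δ i x ≡ r x) → (∀ y → c′ y + δ j′ y ≡ c y) →
                Halves (A ⊕ E i′ j) r′ c′ → Halves S r c
    lift-path {S} {A} {r} {c = c} {i = i} {j} {i′} {j′} A≐S r≡ c≡ H =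
      choose (summand-pos (half₁ i′ j) (subst (1 ≤_) (sym (entry halves-sum i′ j)) unit-at))
      where
      open Halves H
      unit-at : 1 ≤ A i′ j + E i′ j i′ j
      unit-at = subst (λ e → 1 ≤ A i′ j + e) (sym (cong₂ _*_ (δ-self i′) (δ-self j))) (m≤n+m 1 _)
      choose : 1 ≤ half₁ i′ j ⊎ 1 ≤ half₂ i′ j → Halves S r c
      choose (inj₁ pos) = exchange {i = i} {j} {i′} {j′} A≐S r≡ c≡ H pos
      choose (inj₂ pos) = exchange {i = i} {j} {i′} {j′} A≐S r≡ c≡ (swap-halves H) pos

    halves-of-zero : ∀ {S r c} → (∀ x → r x ≡ 0) → Proper (double r) (double c) S → Halves S r c
    halves-of-zero {S} {r} {c} r≡0 (rows , cols) = record
      { half₁ = S ; half₂ = S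
      ; halves-sum = entrywise λ x y → cong (_+ S x y) (S≡0 x y)
      ; proper₁ = proper ; proper₂ = proper }
      where
      S≡0 : ∀ x y → S x y ≡ 0
      S≡0 x = sumFin≡0 J (S x) (trans (rows x) (cong₂ _+_ (r≡0 x) (r≡0 x)))
      c≡0 : ∀ y → c y ≡ 0
      c≡0 y = m+n≡0⇒m≡0 (c y)
                (trans (sym (cols y)) (trans (sumFin-cong I (λ x → S≡0 x y)) (sumFin-zero I)))
      proper : Proper r c S
      proper = (λ x → trans (rows x) (cong (_+ r x) (r≡0 x))) ,
               (λ y → trans (cols y) (cong (_+ c y) (c≡0 y)))

    halve : ∀ m (S : Mat I J) (r : Fin I → ℕ) (c : Fin J → ℕ) → sumFin I r ≡ m →
            Proper (double r) (double c) S → Halves S r c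
    halve zero    S r c Σr≡0 PS = halves-of-zero (sumFin≡0 I r Σr≡0) PS
    halve (suc m) S r c Σr≡ PS = step (reduce {S} {r} {c} (subst (1 ≤_) (sym Σr≡) (s≤s z≤n)) PS)
      where
      step : Reduction S r c → Halves S r c
      step (doubled i j A r′ c′ A≐S r≡ c≡) =
        lift-doubled {i = i} {j} A≐S r≡ c≡
          (halve m A r′ c′ (sumFin-decrement {i = i} r≡ Σr≡)
                 (doubled-margins {i = i} {j} A≐S r≡ c≡ PS))
      step (path i j i′ j′ A r′ c′ A≐S r≡ c≡) =
        lift-path {i = i} {j} {i′} {j′} A≐S r≡ c≡
          (halve m (A ⊕ E i′ j) r′ c′ (sumFin-decrement {i = i} r≡ Σr≡)
                 (path-margins {i = i} {j} {i′} {j′} A≐S r≡ c≡ PS))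

    halving : (S : Mat I J) (r : Fin I → ℕ) (c : Fin J → ℕ) →
              Proper (double r) (double c) S → Halves S r c
    halving S r c = halve _ S r c refl

module Routing where
  open import Data.Nat using (ℕ; zero; suc)
  open import Data.Integer using (ℤ; +_; 0ℤ; _+_; _-_; _*_)
  open import Data.Integer.Properties
    using (+-*-semiring; +-identityˡ; +-assoc; +-inverseʳ; *-zeroˡ; *-zeroʳ; suc-*)
  open import Data.Integer.Tactic.RingSolver using (solve-∀)
  open import Algebra.Properties.Semiring.Sum +-*-semiring
    using (sum; sum-cong-≗; *-distribʳ-sum; sum-replicate-zero)
  open import Data.Fin using (Fin; zero; suc; _≟_)
  open import Relation.Nullary using (yes; no)
  open import Data.List using (List; []; _∷_; _++_; replicate; concat; tabulate)
  open import Function using (_∘_)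
  open import Relation.Binary.PropositionalEquality
    using (_≡_; refl; sym; trans; cong; cong₂; module ≡-Reasoning)
  open ≡-Reasoning

  sum-naturals : ∀ n (f : Fin n → ℕ) → sum (λ k → + f k) ≡ + sumFin n f
  sum-naturals zero    f = refl
  sum-naturals (suc n) f = cong (_+_ (+ f zero)) (sum-naturals n (f ∘ suc))

  sum-difference : ∀ n (u v : Fin n → ℤ) → sum (λ k → u k - v k) ≡ sum u - sum v
  sum-difference zero    u v = refl
  sum-difference (suc n) u v =
    trans (cong (_+_ (u zero - v zero)) (sum-difference n (u ∘ suc) (v ∘ suc)))
          (regroup (u zero) (v zero) _ _)
    where
    regroup : ∀ a b c d → (a - b) + (c - d) ≡ (a + c) - (b + d)
    regroup = solve-∀

  indicator-suc : ∀ {n} (x k : Fin n) → indicator (suc x) (suc k) ≡ indicator x k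
  indicator-suc x k with x ≟ k
  ... | yes _ = refl
  ... | no  _ = refl

  sum-select : ∀ n (u : Fin n → ℤ) x → sum (λ k → u k * indicator x k) ≡ u x
  sum-select (suc n) u zero = begin
    u zero * + 1 + sum (λ k → u (suc k) * + 0)
      ≡⟨ cong (_+_ (u zero * + 1))
              (trans (sum-cong-≗ (λ k → *-zeroʳ (u (suc k)))) (sum-replicate-zero n)) ⟩
    u zero * + 1 + 0ℤ
      ≡⟨ unit (u zero) ⟩
    u zero ∎
    where
    unit : ∀ a → a * + 1 + 0ℤ ≡ a
    unit = solve-∀
  sum-select (suc n) u (suc x) = begin
    u zero * + 0 + sum (λ k → u (suc k) * indicator (suc x) (suc k))
      ≡⟨ cong₂ _+_ (*-zeroʳ (u zero))
                   (sum-cong-≗ (λ k → cong (u (suc k) *_) (indicator-suc x k))) ⟩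
    0ℤ + sum (λ k → u (suc k) * indicator x k)
      ≡⟨ +-identityˡ _ ⟩
    sum (λ k → u (suc k) * indicator x k)
      ≡⟨ sum-select n (u ∘ suc) x ⟩
    u (suc x) ∎

  swap-back : ∀ {a a′ h₁ h₂ z : ℤ} → a + z ≡ h₁ → h₁ + h₂ ≡ a + a′ → a′ - z ≡ h₂
  swap-back {a} {a′} {h₁} {h₂} {z} a+z≡h₁ h₁+h₂≡a+a′ = begin
    a′ - z                ≡⟨ regroup a a′ z ⟩
    (a + a′) - (a + z)    ≡⟨ cong₂ _-_ (sym h₁+h₂≡a+a′) a+z≡h₁ ⟩
    (h₁ + h₂) - h₁        ≡⟨ cancel h₁ h₂ ⟩
    h₂                    ∎
    where
    regroup : ∀ a a′ z → a′ - z ≡ (a + a′) - (a + z)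
    regroup = solve-∀
    cancel : ∀ h₁ h₂ → (h₁ + h₂) - h₁ ≡ h₂
    cancel = solve-∀

  module _ {I J : ℕ} where

    swapMat-++ : ∀ (Z Z′ : List (Move I J)) x y →
                 swapMat (Z ++ Z′) x y ≡ swapMat Z x y + swapMat Z′ x y
    swapMat-++ []      Z′ x y = sym (+-identityˡ _)
    swapMat-++ (m ∷ Z) Z′ x y =
      trans (cong (_+_ (moveMat m x y)) (swapMat-++ Z Z′ x y)) (sym (+-assoc (moveMat m x y) _ _))

    swapMat-replicate : ∀ n (m : Move I J) x y → swapMat (replicate n m) x y ≡ + n * moveMat m x y
    swapMat-replicate zero    m x y = sym (*-zeroˡ (moveMat m x y))
    swapMat-replicate (suc n) m x y =
      trans (cong (_+_ (moveMat m x y)) (swapMat-replicate n m x y))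
            (sym (suc-* (+ n) (moveMat m x y)))

    swapMat-concat : ∀ n (F : Fin n → List (Move I J)) x y →
                     swapMat (concat (tabulate F)) x y ≡ sum (λ k → swapMat (F k) x y)
    swapMat-concat zero    F x y = refl
    swapMat-concat (suc n) F x y =
      trans (swapMat-++ (F zero) _ x y)
            (cong (_+_ (swapMat (F zero) x y)) (swapMat-concat n (F ∘ suc) x y))

    -- Moves at (i, j) through the hub row b: f′ i j units brought in from b,
    -- f i j units sent out to b.
    block : Fin I → (f f′ : Mat I J) → Fin I → Fin J → List (Move I J)
    block b f f′ i j = replicate (f′ i j) (move b i j) ++ replicate (f i j) (move i b j)

    swapMat-block : ∀ b (f f′ : Mat I J) i j x y →
                    swapMat (block b f f′ i j) x y ≡
                    (+ f′ i j - + f i j) * ((indicator x i - indicator x b) * indicator y j)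
    swapMat-block b f f′ i j x y =
      trans (swapMat-++ (replicate (f′ i j) (move b i j)) _ x y)
            (trans (cong₂ _+_ (swapMat-replicate (f′ i j) (move b i j) x y)
                              (swapMat-replicate (f i j) (move i b j) x y))
                   (collect (+ f′ i j) (+ f i j) (indicator x i) (indicator x b) (indicator y j)))
      where
      collect : ∀ p q α β γ → p * (α * γ - β * γ) + q * (β * γ - α * γ) ≡ (p - q) * ((α - β) * γ)
      collect = solve-∀

    route : Fin I → (f f′ : Mat I J) → List (Move I J)
    route b f f′ = concat (tabulate λ i → concat (tabulate λ j → block b f f′ i j))

    difference : (f f′ : Mat I J) → Fin I → Fin J → ℤ
    difference f f′ i j = + f′ i j - + f i j

    difference-balanced : ∀ (f f′ : Mat I J) → (∀ y → colSum f y ≡ colSum f′ y) →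
                          ∀ y → sum (λ i → difference f f′ i y) ≡ 0ℤ
    difference-balanced f f′ cols y = begin
      sum (λ i → difference f f′ i y)                ≡⟨ sum-difference I _ _ ⟩
      sum (λ i → + f′ i y) - sum (λ i → + f i y)     ≡⟨ cong₂ _-_ (sum-naturals I _) (sum-naturals I _) ⟩
      + colSum f′ y - + colSum f y                   ≡⟨ cong (λ t → + colSum f′ y - + t) (cols y) ⟩
      + colSum f′ y - + colSum f′ y                  ≡⟨ +-inverseʳ (+ colSum f′ y) ⟩
      0ℤ                                             ∎

    swapMat-route : ∀ b (f f′ : Mat I J) x y →
                    swapMat (route b f f′) x y ≡
                    difference f f′ x y - sum (λ i → difference f f′ i y) * indicator x b
    swapMat-route b f f′ x y = begin
      swapMat (route b f f′) x y
        ≡⟨ trans (swapMat-concat I (λ i → concat (tabulate (block b f f′ i))) x y)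
                 (sum-cong-≗ (λ i → swapMat-concat J (block b f f′ i) x y)) ⟩
      sum (λ i → sum (λ j → swapMat (block b f f′ i j) x y))
        ≡⟨ sum-cong-≗ (λ i → sum-cong-≗ (λ j → swapMat-block b f f′ i j x y)) ⟩
      sum (λ i → sum (λ j → d i j * ((indicator x i - indicator x b) * indicator y j)))
        ≡⟨ sum-cong-≗ (λ i → trans (sum-cong-≗ (λ j → reassoc (d i j) _ (indicator y j)))
                                   (sum-select J (λ j → d i j * (indicator x i - indicator x b)) y)) ⟩
      sum (λ i → d i y * (indicator x i - indicator x b))
        ≡⟨ sum-cong-≗ (λ i → distrib (d i y) (indicator x i) (indicator x b)) ⟩
      sum (λ i → d i y * indicator x i - d i y * indicator x b)
        ≡⟨ sum-difference I _ _ ⟩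
      sum (λ i → d i y * indicator x i) - sum (λ i → d i y * indicator x b)
        ≡⟨ cong₂ _-_ (sum-select I (λ i → d i y) x)
                     (sym (*-distribʳ-sum (indicator x b) (λ i → d i y))) ⟩
      d x y - sum (λ i → d i y) * indicator x b
        ∎
      where
      d : Fin I → Fin J → ℤ
      d = difference f f′
      reassoc : ∀ p α γ → p * (α * γ) ≡ (p * α) * γ
      reassoc = solve-∀
      distrib : ∀ p α β → p * (α - β) ≡ p * α - p * β
      distrib = solve-∀

    routing : ∀ b (f f′ : Mat I J) → (∀ y → colSum f y ≡ colSum f′ y) →
              ∀ x y → + f x y + swapMat (route b f f′) x y ≡ + f′ x y
    routing b f f′ cols x y = begin
      + f x y + swapMat (route b f f′) x y
        ≡⟨ cong (_+_ (+ f x y)) (swapMat-route b f f′ x y) ⟩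
      + f x y + (difference f f′ x y - sum (λ i → difference f f′ i y) * indicator x b)
        ≡⟨ cong (λ t → + f x y + (difference f f′ x y - t * indicator x b))
                (difference-balanced f f′ cols y) ⟩
      + f x y + ((+ f′ x y - + f x y) - 0ℤ * indicator x b)
        ≡⟨ settle (+ f x y) (+ f′ x y) (indicator x b) ⟩
      + f′ x y ∎
      where
      settle : ∀ a a′ γ → a + ((a′ - a) - 0ℤ * γ) ≡ a′
      settle = solve-∀

open import Data.Nat as ℕ using (ℕ)
open import Data.Integer using (+_; _+_; _-_)
open import Data.Fin using (Fin)
open import Data.List using (List)
open import Data.Product using (Σ; _×_; _,_; proj₂)
open import Data.Sum using (_⊎_)
open import Relation.Binary.PropositionalEquality using (_≡_; _≢_; trans; sym; cong; cong₂)
open Halving using (_⊕_; Halves; halving; colSum-⊕; entry)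
open Routing using (route; routing; swap-back)

lemma4p5 : (I J : ℕ) (r : Fin I → ℕ) (c : Fin J → ℕ) →
    sumFin I r ≡ sumFin J c →
    (N : ℕ) (g : Fin N → Mat I J) →
    (∀ k → Proper r c (g k) ⊎ WithCollision r c (g k)) →
    (k k′ : Fin N) → k ≢ k′ →
    WithCollision r c (g k) → WithCollision r c (g k′) →
    (∀ i → sumFin J (λ j → g k i j ℕ.+ g k′ i j) ≡ r i ℕ.+ r i) →
    Σ (List (Move I J)) λ Z →
      ProperℤMat r c (λ i j → + g k i j + swapMat Z i j) ×
      ProperℤMat r c (λ i j → + g k′ i j - swapMat Z i j)
lemma4p5 I J r c _ N g _ k k′ _ (colsₖ , hub , _) (colsₖ′ , _) rows =
  Z , (half₁ , reach , proper₁) , (half₂ , reach′ , proper₂)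
  where
  -- g k + g k′ has margins (2r, 2c); split it into two proper graphs.
  open Halves (halving (g k ⊕ g k′) r c
                 (rows , λ y → trans (colSum-⊕ (g k) (g k′) y) (cong₂ ℕ._+_ (colsₖ y) (colsₖ′ y))))
  Z : List (Move I J)
  Z = route hub (g k) half₁
  reach : ∀ x y → + g k x y + swapMat Z x y ≡ + half₁ x y
  reach = routing hub (g k) half₁ (λ y → trans (colsₖ y) (sym (proj₂ proper₁ y)))
  reach′ : ∀ x y → + g k′ x y - swapMat Z x y ≡ + half₂ x y
  reach′ x y = swap-back {+ g k x y} {+ g k′ x y} {+ half₁ x y} {+ half₂ x y} {swapMat Z x y}
                 (reach x y) (cong +_ (entry halves-sum x y))
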